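{- Let $\langle A,\rightarrow,\top\rangle$ be a BCI-algebra such that $\langle A,\preceq\rangle$ is a meet-semilattice and $x\rightarrow(y\wedge z)=(x\rightarrow y)\wedge(x\rightarrow z)$ for all $x,y,z\in A$. Let $\mathbb{A}=\{[\underline X,\overline X]:\underline X,\overline X\in A,\ \underline X\preceq\overline X\}$ and for $X,Y\in\mathbb{A}$ define $X\Rightarrow\!\!> Y=[\overline{X}\rightarrow\underline{Y},\ \underline{X}\rightarrow\overline{Y}]$ and $X\Rightarrow Y=[(\underline{X}\rightarrow\underline{Y})\wedge(\overline{X}\rightarrow\overline{Y}),\ \underline{X}\rightarrow\overline{Y}]$. Define $X\ll Y$ iff $X\Rightarrow\!\!> Y=[\top,\top]$ and $X\precsim Y$ iff $X\Rightarrow Y=[\top,\top]$. Then $\Rightarrow\!\!>$ is the best interval representation of $\rightarrow$, and for all $X,Y,Z\in\mathbb{A}$: (1) $X\Rightarrow\!\!>(Y\Rightarrow\!\!> Z)=Y\Rightarrow\!\!>(X\Rightarrow\!\!> Z)$; (2) $X\Rightarrow(Y\Rightarrow Z)=Y\Rightarrow(X\Rightarrow Z)$; (3) $X\Rightarrow\!\!> Y\precsim(Z\Rightarrow\!\!> X)\Rightarrow(Z\Rightarrow\!\!> Y)$; (4) $[\top,\top]\Rightarrow\!\!> X=X$; (5) if $X\ll Y\precsim Z$ then $X\ll Z$; (6) if $X\precsim Y\ll Z$ then $X\ll Z$; (7) if $X\precsim Y$ and $Y\precsim X$ then $X=Y$. Moreover, if $A$ has at least one element different from $\top$, then $\langle\mathbb{A},\Rightarrow\!\!>,[\top,\top]\rangle$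 is not a BCI-algebra.
   Context: A BCI-algebra is a structure $\langle B,\rightarrow,\top\rangle$, with $\rightarrow$ a binary operation on $B$ and $\top\in B$, such that for all $x,y,z\in B$: (C1) $(y\rightarrow z)\rightarrow((z\rightarrow x)\rightarrow(y\rightarrow x))=\top$; (C2) $x\rightarrow((x\rightarrow y)\rightarrow y)=\top$; (C3) $x\rightarrow x=\top$; (C4) if $x\rightarrow y=\top$ and $y\rightarrow x=\top$ then $x=y$. Its induced relation is $x\preceq y$ iff $x\rightarrow y=\top$ (a partial order); $\wedge$ denotes meet w.r.t. $\preceq$. For $X=[a,b]\in\mathbb{A}$, $\underline X=a$, $\overline X=b$, and $x\in X$ means $\underline X\preceq x\preceq\overline X$. An operation $F:\mathbb{A}\times\mathbb{A}\to\mathbb{A}$ is an interval representation of $\rightarrow$ if $x\rightarrow y\in F(X,Y)$ whenever $x\in X$, $y\in Y$; it is the best interval representation if it is an interval representation and $F(X,Y)\subseteq G(X,Y)$ (as sets of elements of $A$) for every interval representation $G$ of $\rightarrow$ and all $X,Y\in\mathbb{A}$. -}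

module Defs where

open import Level using (Level; suc)
open import Data.Product using (_×_; _,_; proj₁; proj₂)
open import Relation.Binary.PropositionalEquality using (_≡_)

record BCIAlgebra (a : Level) : Set (suc a) where
  infixr 5 _⇒_
  field
    Carrier : Set a
    _⇒_     : Carrier → Carrier → Carrier
    ⊤       : Carrier
    C1 : ∀ x y z → (y ⇒ z) ⇒ ((z ⇒ x) ⇒ (y ⇒ x)) ≡ ⊤
    C2 : ∀ x y → x ⇒ ((x ⇒ y) ⇒ y) ≡ ⊤
    C3 : ∀ x → x ⇒ x ≡ ⊤
    C4 : ∀ x y → x ⇒ y ≡ ⊤ → y ⇒ x ≡ ⊤ → x ≡ y

  _≼_ : Carrier → Carrier → Set a
  x ≼ y = x ⇒ y ≡ ⊤

-- The BCI axioms for an operation on a type B, with equality _≈_, restricted to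
-- the elements satisfying P (used to say "⟨𝔸, ⇒>, [⊤,⊤]⟩ is a BCI-algebra").
record IsBCIOn {b p e : Level} {B : Set b} (P : B → Set p) (_≈_ : B → B → Set e)
               (_⇒_ : B → B → B) (⊤ : B) : Set (b Level.⊔ p Level.⊔ e) where
  field
    C1 : ∀ x y z → P x → P y → P z → ((y ⇒ z) ⇒ ((z ⇒ x) ⇒ (y ⇒ x))) ≈ ⊤
    C2 : ∀ x y → P x → P y → (x ⇒ ((x ⇒ y) ⇒ y)) ≈ ⊤
    C3 : ∀ x → P x → (x ⇒ x) ≈ ⊤
    C4 : ∀ x y → P x → P y → (x ⇒ y) ≈ ⊤ → (y ⇒ x) ≈ ⊤ → x ≈ y

record MeetBCI (a : Level) : Set (suc a) where
  field
    bci : BCIAlgebra a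
  open BCIAlgebra bci public
  infixr 6 _∧_
  field
    _∧_    : Carrier → Carrier → Carrier
    ∧-lb₁  : ∀ x y → (x ∧ y) ≼ x
    ∧-lb₂  : ∀ x y → (x ∧ y) ≼ y
    ∧-glb  : ∀ x y z → z ≼ x → z ≼ y → z ≼ (x ∧ y)
    ⇒-∧    : ∀ x y z → x ⇒ (y ∧ z) ≡ (x ⇒ y) ∧ (x ⇒ z)

module Intervals {a : Level} (M : MeetBCI a) where
  open MeetBCI M

  -- an interval [lo, hi] is represented by the pair (lo , hi);
  -- it belongs to 𝔸 iff lo ≼ hi (predicate WF).
  Int : Set a
  Int = Carrier × Carrier

  lo hi : Int → Carrier
  lo = proj₁
  hi = proj₂

  WF : Int → Set a
  WF X = lo X ≼ hi X

  _∈_ : Carrier → Int → Set a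
  x ∈ X = (lo X ≼ x) × (x ≼ hi X)

  ⊤⊤ : Int
  ⊤⊤ = ⊤ , ⊤

  infixr 5 _⇒>_ _⟹_
  _⇒>_ : Int → Int → Int
  X ⇒> Y = (hi X ⇒ lo Y) , (lo X ⇒ hi Y)

  _⟹_ : Int → Int → Int
  X ⟹ Y = ((lo X ⇒ lo Y) ∧ (hi X ⇒ hi Y)) , (lo X ⇒ hi Y)

  _≪_ : Int → Int → Set a
  X ≪ Y = X ⇒> Y ≡ ⊤⊤

  _≾_ : Int → Int → Set a
  X ≾ Y = X ⟹ Y ≡ ⊤⊤

  IsIntervalRep : (Int → Int → Int) → Set a
  IsIntervalRep F =
    (∀ X Y → WF X → WF Y → WF (F X Y)) ×
    (∀ X Y x y → WF X → WF Y → x ∈ X → y ∈ Y → (x ⇒ y) ∈ F X Y)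

  IsBestIntervalRep : (Int → Int → Int) → Set a
  IsBestIntervalRep F =
    IsIntervalRep F ×
    (∀ (G : Int → Int → Int) → IsIntervalRep G →
       ∀ X Y → WF X → WF Y → ∀ z → z ∈ F X Y → z ∈ G X Y)

module Submission where

-- Every clause of the theorem is a statement about the endpoints of
-- intervals, so the proof reduces to the order theory of the underlying
-- algebra.  Finally, if ⟨𝔸, ⇒>, [⊤,⊤]⟩ satisfied C3 then
--      every interval would be a single point, which fails for [x ∧ ⊤, x]
--      and [x ∧ ⊤, ⊤] as soon as some x ≠ ⊤.

open import Defs
open import Level using (Level)
open import Data.Product using (_×_; _,_; ∃; proj₁; proj₂)
open import Relation.Binary.PropositionalEquality
  using (_≡_; _≢_; refl; sym; trans; cong; cong₂; subst; module ≡-Reasoning)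
open import Relation.Nullary using (¬_)

module BCIProperties {a : Level} (B : BCIAlgebra a) where
  open BCIAlgebra B

  ≼-⊤⇒ : ∀ x → x ≼ (⊤ ⇒ x)
  ≼-⊤⇒ x = subst (λ w → x ⇒ (w ⇒ x) ≡ ⊤) (C3 x) (C2 x x)

  ⊤≼⇒≡⊤ : ∀ {u} → ⊤ ≼ u → u ≡ ⊤
  ⊤≼⇒≡⊤ {u} ⊤≼u = C4 u ⊤ (subst (u ≼_) ⊤≼u (≼-⊤⇒ u)) ⊤≼u

  ⊤⇒-identity : ∀ x → ⊤ ⇒ x ≡ x
  ⊤⇒-identity x = sym (C4 x (⊤ ⇒ x) (≼-⊤⇒ x) (⊤≼⇒≡⊤ (C2 ⊤ x)))

  modus-ponens : ∀ {u v} → u ≡ ⊤ → u ⇒ v ≡ ⊤ → v ≡ ⊤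
  modus-ponens refl ⊤⇒v≡⊤ = ⊤≼⇒≡⊤ ⊤⇒v≡⊤

  ≼-trans : ∀ {x y z} → x ≼ y → y ≼ z → x ≼ z
  ≼-trans {x} {y} {z} x≼y y≼z = modus-ponens y≼z (modus-ponens x≼y (C1 z x y))

  ⇒-antitone : ∀ {y z} x → y ≼ z → (z ⇒ x) ≼ (y ⇒ x)
  ⇒-antitone {y} {z} x y≼z = modus-ponens y≼z (C1 x y z)

  ⇒-monotone : ∀ {y z} x → y ≼ z → (x ⇒ y) ≼ (x ⇒ z)
  ⇒-monotone {y} {z} x y≼z = subst ((x ⇒ y) ≼_) premise-discharged (C1 z x y)
    where
    premise-discharged : (y ⇒ z) ⇒ (x ⇒ z) ≡ x ⇒ z
    premise-discharged = trans (cong (_⇒ (x ⇒ z)) y≼z) (⊤⇒-identity (x ⇒ z))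

  exchange≼ : ∀ x y z → (x ⇒ (y ⇒ z)) ≼ (y ⇒ (x ⇒ z))
  exchange≼ x y z = ≼-trans (C1 z x (y ⇒ z)) (⇒-antitone (x ⇒ z) (C2 y z))

  exchange : ∀ x y z → x ⇒ (y ⇒ z) ≡ y ⇒ (x ⇒ z)
  exchange x y z = C4 _ _ (exchange≼ x y z) (exchange≼ y x z)

  -- Prefixing: y ⇒ z ≼ (x ⇒ y) ⇒ (x ⇒ z), i.e. C1 with the premises exchanged.
  prefixing : ∀ x y z → (y ⇒ z) ≼ ((x ⇒ y) ⇒ (x ⇒ z))
  prefixing x y z = trans (exchange (y ⇒ z) (x ⇒ y) (x ⇒ z)) (C1 z x y)

module MeetProperties {a : Level} (M : MeetBCI a) where
  open MeetBCI M
  open BCIProperties bci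

  ∧-⊤ : ⊤ ∧ ⊤ ≡ ⊤
  ∧-⊤ = C4 _ _ (∧-lb₁ ⊤ ⊤) (∧-glb ⊤ ⊤ ⊤ (C3 ⊤) (C3 ⊤))

  ∧≡⊤ˡ : ∀ {x y} → x ∧ y ≡ ⊤ → x ≡ ⊤
  ∧≡⊤ˡ {x} {y} e = ⊤≼⇒≡⊤ (subst (_≼ x) e (∧-lb₁ x y))

  ∧≡⊤ʳ : ∀ {x y} → x ∧ y ≡ ⊤ → y ≡ ⊤
  ∧≡⊤ʳ {x} {y} e = ⊤≼⇒≡⊤ (subst (_≼ y) e (∧-lb₂ x y))

  ∧-swap-inner≼ : ∀ x y z → ((x ∧ y) ∧ z) ≼ ((x ∧ z) ∧ y)
  ∧-swap-inner≼ x y z = ∧-glb _ _ _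
    (∧-glb _ _ _ (≼-trans (∧-lb₁ _ _) (∧-lb₁ _ _)) (∧-lb₂ _ _))
    (≼-trans (∧-lb₁ _ _) (∧-lb₂ _ _))

  ∧-swap-inner : ∀ x y z → (x ∧ y) ∧ z ≡ (x ∧ z) ∧ y
  ∧-swap-inner x y z = C4 _ _ (∧-swap-inner≼ x y z) (∧-swap-inner≼ x z y)

module IntervalProperties {a : Level} (M : MeetBCI a) where
  open MeetBCI M
  open Intervals M
  open BCIProperties bci
  open MeetProperties M

  ≪-intro : ∀ {X Y} → hi X ≼ lo Y → lo X ≼ hi Y → X ≪ Y
  ≪-intro = cong₂ _,_

  ≪-hi-lo : ∀ {X Y} → X ≪ Y → hi X ≼ lo Y
  ≪-hi-lo = cong proj₁

  ≪-lo-hi : ∀ {X Y} → X ≪ Y → lo X ≼ hi Y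
  ≪-lo-hi = cong proj₂

  -- X ≾ Y says lo X ≼ lo Y and hi X ≼ hi Y (lo X ≼ hi Y then follows when
  -- X is an interval).
  ≾-intro : ∀ {X Y} → WF X → lo X ≼ lo Y → hi X ≼ hi Y → X ≾ Y
  ≾-intro wX lo≼ hi≼ =
    cong₂ _,_ (trans (cong₂ _∧_ lo≼ hi≼) ∧-⊤) (≼-trans wX hi≼)

  ≾-lo : ∀ {X Y} → X ≾ Y → lo X ≼ lo Y
  ≾-lo e = ∧≡⊤ˡ (cong proj₁ e)

  ≾-hi : ∀ {X Y} → X ≾ Y → hi X ≼ hi Y
  ≾-hi e = ∧≡⊤ʳ (cong proj₁ e)

  ⇒>-WF : ∀ X Y → WF X → WF Y → WF (X ⇒> Y)
  ⇒>-WF (lx , hx) (ly , hy) wX wY = ≼-trans (⇒-antitone ly wX) (⇒-monotone lx wY)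

  ⇒>-sound : ∀ X Y x y → WF X → WF Y → x ∈ X → y ∈ Y → (x ⇒ y) ∈ (X ⇒> Y)
  ⇒>-sound (lx , hx) (ly , hy) x y _ _ (lx≼x , x≼hx) (ly≼y , y≼hy) =
    ≼-trans (⇒-antitone ly x≼hx) (⇒-monotone x ly≼y) ,
    ≼-trans (⇒-antitone y lx≼x) (⇒-monotone lx y≼hy)

  -- Any representation G must contain hi X ⇒ lo Y and lo X ⇒ hi Y, the
  -- endpoints of X ⇒> Y, hence all of X ⇒> Y.
  ⇒>-least : ∀ (G : Int → Int → Int) → IsIntervalRep G →
    ∀ X Y → WF X → WF Y → ∀ z → z ∈ (X ⇒> Y) → z ∈ G X Y
  ⇒>-least G (_ , G-sound) X@(lx , hx) Y@(ly , hy) wX wY z (lo≼z , z≼hi) =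
    ≼-trans (proj₁ (G-sound X Y hx ly wX wY (wX , C3 hx) (C3 ly , wY))) lo≼z ,
    ≼-trans z≼hi (proj₂ (G-sound X Y lx hy wX wY (C3 lx , wX) (wY , C3 hy)))

  ⇒>-best : IsBestIntervalRep _⇒>_
  ⇒>-best = (⇒>-WF , ⇒>-sound) , ⇒>-least

  ⇒>-exchange : ∀ X Y Z → X ⇒> (Y ⇒> Z) ≡ Y ⇒> (X ⇒> Z)
  ⇒>-exchange (lx , hx) (ly , hy) (lz , hz) =
    cong₂ _,_ (exchange hx hy lz) (exchange lx ly hz)

  ⟹-exchange : ∀ X Y Z → X ⟹ (Y ⟹ Z) ≡ Y ⟹ (X ⟹ Z)
  ⟹-exchange (lx , hx) (ly , hy) (lz , hz) = cong₂ _,_ lower (exchange lx ly hz)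
    where
    open ≡-Reasoning
    lower : (lx ⇒ ((ly ⇒ lz) ∧ (hy ⇒ hz))) ∧ (hx ⇒ (ly ⇒ hz))
          ≡ (ly ⇒ ((lx ⇒ lz) ∧ (hx ⇒ hz))) ∧ (hy ⇒ (lx ⇒ hz))
    lower = begin
      (lx ⇒ ((ly ⇒ lz) ∧ (hy ⇒ hz))) ∧ (hx ⇒ (ly ⇒ hz))
        ≡⟨ cong (_∧ (hx ⇒ (ly ⇒ hz))) (⇒-∧ lx _ _) ⟩
      ((lx ⇒ (ly ⇒ lz)) ∧ (lx ⇒ (hy ⇒ hz))) ∧ (hx ⇒ (ly ⇒ hz))
        ≡⟨ cong₂ _∧_ (cong₂ _∧_ (exchange lx ly lz) (exchange lx hy hz))
                     (exchange hx ly hz) ⟩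
      ((ly ⇒ (lx ⇒ lz)) ∧ (hy ⇒ (lx ⇒ hz))) ∧ (ly ⇒ (hx ⇒ hz))
        ≡⟨ ∧-swap-inner _ _ _ ⟩
      ((ly ⇒ (lx ⇒ lz)) ∧ (ly ⇒ (hx ⇒ hz))) ∧ (hy ⇒ (lx ⇒ hz))
        ≡⟨ cong (_∧ (hy ⇒ (lx ⇒ hz))) (sym (⇒-∧ ly _ _)) ⟩
      (ly ⇒ ((lx ⇒ lz) ∧ (hx ⇒ hz))) ∧ (hy ⇒ (lx ⇒ hz))
        ∎

  ⇒>-prefixing : ∀ X Y Z → WF X → WF Y → WF Z →
    (X ⇒> Y) ≾ ((Z ⇒> X) ⟹ (Z ⇒> Y))
  ⇒>-prefixing X@(lx , hx) Y@(ly , hy) (lz , hz) wX wY wZ =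
    ≾-intro (⇒>-WF X Y wX wY) lower upper
    where
    lower : (hx ⇒ ly) ≼ (((hz ⇒ lx) ⇒ (hz ⇒ ly)) ∧ ((lz ⇒ hx) ⇒ (lz ⇒ hy)))
    lower = ∧-glb _ _ _
      (≼-trans (⇒-antitone ly wX) (prefixing hz lx ly))
      (≼-trans (⇒-monotone hx wY) (prefixing lz hx hy))
    upper : (lx ⇒ hy) ≼ ((hz ⇒ lx) ⇒ (lz ⇒ hy))
    upper = ≼-trans (prefixing hz lx hy) (⇒-monotone (hz ⇒ lx) (⇒-antitone hy wZ))

  ⊤⊤⇒>-identity : ∀ X → ⊤⊤ ⇒> X ≡ X
  ⊤⊤⇒>-identity (lx , hx) = cong₂ _,_ (⊤⇒-identity lx) (⊤⇒-identity hx)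

  ≪-≾-trans : ∀ {X Y Z} → X ≪ Y → Y ≾ Z → X ≪ Z
  ≪-≾-trans X≪Y Y≾Z =
    ≪-intro (≼-trans (≪-hi-lo X≪Y) (≾-lo Y≾Z)) (≼-trans (≪-lo-hi X≪Y) (≾-hi Y≾Z))

  ≾-≪-trans : ∀ {X Y Z} → X ≾ Y → Y ≪ Z → X ≪ Z
  ≾-≪-trans X≾Y Y≪Z =
    ≪-intro (≼-trans (≾-hi X≾Y) (≪-hi-lo Y≪Z)) (≼-trans (≾-lo X≾Y) (≪-lo-hi Y≪Z))

  ≾-antisym : ∀ {X Y} → X ≾ Y → Y ≾ X → X ≡ Y
  ≾-antisym X≾Y Y≾X =
    cong₂ _,_ (C4 _ _ (≾-lo X≾Y) (≾-lo Y≾X)) (C4 _ _ (≾-hi X≾Y) (≾-hi Y≾X))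

  -- Axiom C3 for ⇒> requires hi X ≼ lo X, so it only holds on point intervals.
  C3-degenerate : IsBCIOn WF _≡_ _⇒>_ ⊤⊤ → ∀ X → WF X → lo X ≡ hi X
  C3-degenerate isBCI X wX = C4 _ _ wX (cong proj₁ (IsBCIOn.C3 isBCI X wX))

  not-BCI : (∃ λ (x : Carrier) → x ≢ ⊤) → ¬ IsBCIOn WF _≡_ _⇒>_ ⊤⊤
  not-BCI (x , x≢⊤) isBCI = x≢⊤ (trans (sym x∧⊤≡x) x∧⊤≡⊤)
    where
    x∧⊤≡x : x ∧ ⊤ ≡ x
    x∧⊤≡x = C3-degenerate isBCI (x ∧ ⊤ , x) (∧-lb₁ x ⊤)
    x∧⊤≡⊤ : x ∧ ⊤ ≡ ⊤
    x∧⊤≡⊤ = C3-degenerate isBCI (x ∧ ⊤ , ⊤) (∧-lb₂ x ⊤)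

theorem2 : ∀ {a : Level} (M : MeetBCI a) →
    let open MeetBCI M in
    let open Intervals M in
      IsBestIntervalRep _⇒>_
    × (∀ X Y Z → WF X → WF Y → WF Z → X ⇒> (Y ⇒> Z) ≡ Y ⇒> (X ⇒> Z))
    × (∀ X Y Z → WF X → WF Y → WF Z → X ⟹ (Y ⟹ Z) ≡ Y ⟹ (X ⟹ Z))
    × (∀ X Y Z → WF X → WF Y → WF Z → (X ⇒> Y) ≾ ((Z ⇒> X) ⟹ (Z ⇒> Y)))
    × (∀ X → WF X → ⊤⊤ ⇒> X ≡ X)
    × (∀ X Y Z → WF X → WF Y → WF Z → X ≪ Y → Y ≾ Z → X ≪ Z)
    × (∀ X Y Z → WF X → WF Y → WF Z → X ≾ Y → Y ≪ Z → X ≪ Z)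
    × (∀ X Y → WF X → WF Y → X ≾ Y → Y ≾ X → X ≡ Y)
    × ((∃ λ (x : Carrier) → x ≢ ⊤) → ¬ IsBCIOn WF _≡_ _⇒>_ ⊤⊤)
theorem2 M =
    ⇒>-best
  , (λ X Y Z _ _ _ → ⇒>-exchange X Y Z)
  , (λ X Y Z _ _ _ → ⟹-exchange X Y Z)
  , ⇒>-prefixing
  , (λ X _ → ⊤⊤⇒>-identity X)
  , (λ _ _ _ _ _ _ → ≪-≾-trans)
  , (λ _ _ _ _ _ _ → ≾-≪-trans)
  , (λ _ _ _ _ → ≾-antisym)
  , not-BCI
  where open IntervalProperties M
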